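{- Let $q=4$. The groups $G_4$ and $G_4^*$ have the same plane orbits and the same point orbits.
   Context: Points of $\mathrm{PG}(3,4)$ are written $\mathbf{P}(x_0,x_1,x_2,x_3)$. For $t\in\mathbb{F}_4$ put $P(t)=\mathbf{P}(t^3,t^2,t,1)$, and $P(\infty)=\mathbf{P}(1,0,0,0)$. The twisted cubic is $\mathcal{C}=\{P(t):t\in\mathbb F_4\cup\{\infty\}\}$. $G_4$ is the group of all projectivities of $\mathrm{PG}(3,4)$ mapping $\mathcal C$ to itself. $G_4^*$ is the subgroup of $G_4$ of projectivities given by matrices $$M(a,b,c,d)=\begin{pmatrix} a^3&a^2c&ac^2&c^3\\ 3a^2b&a^2d+2abc&bc^2+2acd&3c^2d\\ 3ab^2&b^2c+2abd&ad^2+2bcd&3cd^2\\ b^3&b^2d&bd^2&d^3\end{pmatrix},\quad a,b,c,d\in\mathbb F_4,\ ad-bc\ne0,$$ with coefficients read in $\mathbb F_4$. -}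

module Defs where

open import Data.Nat using (ℕ; zero; suc)
open import Data.Fin using (Fin; zero; suc; punchIn)
open import Data.Maybe using (Maybe; just; nothing)
open import Data.Product using (Σ; ∃; _×_; _,_)
open import Relation.Binary.PropositionalEquality using (_≡_; _≢_)
open import Function.Bundles using (_⇔_)

data F4 : Set where
  𝟘 𝟙 ω ω² : F4

infixl 6 _+_ _-_
infixl 7 _*_

_+_ : F4 → F4 → F4
𝟘  + y  = y
x  + 𝟘  = x
𝟙  + 𝟙  = 𝟘
𝟙  + ω  = ω²
𝟙  + ω² = ω
ω  + 𝟙  = ω²
ω  + ω  = 𝟘
ω  + ω² = 𝟙
ω² + 𝟙  = ω
ω² + ω  = 𝟙
ω² + ω² = 𝟘

_*_ : F4 → F4 → F4
𝟘  * y  = 𝟘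
x  * 𝟘  = 𝟘
𝟙  * y  = y
x  * 𝟙  = x
ω  * ω  = ω²
ω  * ω² = 𝟙
ω² * ω  = 𝟙
ω² * ω² = ω

-- additive inverse (characteristic 2, so -x = x)
neg : F4 → F4
neg x = x

_-_ : F4 → F4 → F4
x - y = x + neg y

-- the integer constants 2 and 3 read in F_4
two three : F4 → F4
two x   = x + x
three x = x + x + x

_³ _² : F4 → F4
x ² = x * x
x ³ = x * x * x

Vec4 : Set
Vec4 = Fin 4 → F4

Mat : ℕ → Set
Mat n = Fin n → Fin n → F4

sumF : ∀ n → (Fin n → F4) → F4
sumF zero    f = 𝟘
sumF (suc n) f = f zero + sumF n (λ i → f (suc i))

signed : ∀ {n} → Fin n → F4 → F4
signed zero          x = x
signed (suc zero)    x = neg x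
signed (suc (suc j)) x = signed j x

det : ∀ n → Mat n → F4
det zero    M = 𝟙
det (suc n) M =
  sumF (suc n) (λ j → signed j (M zero j * det n (λ i k → M (suc i) (punchIn j k))))

Nonsingular : Mat 4 → Set
Nonsingular M = det 4 M ≢ 𝟘

apply : Mat 4 → Vec4 → Vec4
apply M x i = sumF 4 (λ j → M i j * x j)

NonZero : Vec4 → Set
NonZero x = ∃ λ i → x i ≢ 𝟘

_∼_ : Vec4 → Vec4 → Set
x ∼ y = Σ F4 λ l → (l ≢ 𝟘) × (∀ i → x i ≡ l * y i)

vec : F4 → F4 → F4 → F4 → Vec4
vec a b c d zero                   = a
vec a b c d (suc zero)             = b
vec a b c d (suc (suc zero))       = c
vec a b c d (suc (suc (suc zero))) = d

-- F_4 ∪ {∞}, with nothing = ∞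
P : Maybe F4 → Vec4
P (just t) = vec (t ³) (t ²) t 𝟙
P nothing  = vec 𝟙 𝟘 𝟘 𝟘

G4 : Mat 4 → Set
G4 M = Nonsingular M
     × (∀ t → ∃ λ s → apply M (P t) ∼ P s)
     × (∀ s → ∃ λ t → apply M (P t) ∼ P s)

M[_,_,_,_] : F4 → F4 → F4 → F4 → Mat 4
M[ a , b , c , d ] = rows
  where
  rows : Mat 4
  rows zero                   = vec (a ³) (a ² * c) (a * c ²) (c ³)
  rows (suc zero)             = vec (three (a ² * b)) (a ² * d + two (a * b * c))
                                    (b * c ² + two (a * c * d)) (three (c ² * d))
  rows (suc (suc zero))       = vec (three (a * b ²)) (b ² * c + two (a * b * d))
                                    (a * d ² + two (b * c * d)) (three (c * d ²))
  rows (suc (suc (suc zero))) = vec (b ³) (b ² * d) (b * d ²) (d ³)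

-- M represents an element of G_4^* (matrices are taken up to a nonzero scalar,
-- as they represent projectivities)
G4* : Mat 4 → Set
G4* M = Σ F4 λ a → Σ F4 λ b → Σ F4 λ c → Σ F4 λ d → Σ F4 λ l →
        (a * d - b * c ≢ 𝟘) × (l ≢ 𝟘) × (∀ i j → M i j ≡ l * M[ a , b , c , d ] i j)

PointOrb : (Mat 4 → Set) → Vec4 → Vec4 → Set
PointOrb G x y = Σ (Mat 4) λ M → G M × (apply M x ∼ y)

OnPlane : Vec4 → Vec4 → Set
OnPlane u x = sumF 4 (λ i → u i * x i) ≡ 𝟘

MapsPlane : Mat 4 → Vec4 → Vec4 → Set
MapsPlane M u v = ∀ x → NonZero x → (OnPlane u x ⇔ OnPlane v (apply M x))

PlaneOrb : (Mat 4 → Set) → Vec4 → Vec4 → Set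
PlaneOrb G u v = Σ (Mat 4) λ M → G M × MapsPlane M u v

-- In characteristic 2 the matrix M(a,b,c,d) is the Kronecker product A⁽²⁾ ⊗ A of the
-- Frobenius twist of A = [[a, c], [b, d]] with A itself, so A ↦ M(A) is multiplicative and
-- G₄* is the image of GL(2,4), acting on C as PGL(2,4) acts on ℙ¹.  The five points of C
-- form a frame of PG(3,4), so an element of G₄ is determined up to a scalar by the
-- permutation it induces on C; since PGL(2,4) is sharply 3-transitive, composing with the
-- Möbius map that agrees on ∞, 0, 1 leaves the identity or the swap of ω and ω², and the
-- latter is induced by the coordinate swap 𝐒 : x₁ ↔ x₂ (the Frobenius t ↦ t²).  Hence
-- G₄ = G₄* ∪ G₄* 𝐒.  Finally every point x is in the G₄*-orbit of 𝐒 x, say 𝐒 x ∼ M(G) x,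
-- so M(A) 𝐒 x ∼ M(A G) x; dually for planes.

module Submission where

open import Defs
open import Data.Empty using (⊥-elim)
open import Data.Fin using (Fin; zero; suc; punchIn)
import Data.Fin.Properties as Fin
open import Data.Maybe using (Maybe; just; nothing)
open import Data.Maybe.Properties using (≡-dec)
open import Data.Nat using (zero; suc)
open import Data.Product using (Σ; ∃; _×_; _,_; proj₁; proj₂)
open import Data.Sum using (_⊎_; inj₁; inj₂) renaming (map to ⊎-map)
open import Function.Bundles using (_⇔_; mk⇔; Equivalence)
open import Relation.Binary.Bundles using (Setoid)
open import Relation.Binary.Definitions using (DecidableEquality)
open import Relation.Binary.PropositionalEquality
  using (_≡_; _≢_; refl; sym; trans; cong; cong₂; module ≡-Reasoning)
import Relation.Binary.Reasoning.Setoid as SetoidReasoning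
open import Relation.Nullary using (Dec; yes; no)
open import Relation.Nullary.Decidable
  using (True; toWitness; _×-dec_; _⊎-dec_; _→-dec_; ¬?; map′)

by-decision : {A : Set} (a? : Dec A) → {True a?} → A
by-decision _ {t} = toWitness t

infix 4 _≟_
_≟_ : DecidableEquality F4
𝟘  ≟ 𝟘  = yes refl
𝟙  ≟ 𝟙  = yes refl
ω  ≟ ω  = yes refl
ω² ≟ ω² = yes refl
𝟘  ≟ 𝟙  = no λ ()
𝟘  ≟ ω  = no λ ()
𝟘  ≟ ω² = no λ ()
𝟙  ≟ 𝟘  = no λ ()
𝟙  ≟ ω  = no λ ()
𝟙  ≟ ω² = no λ ()
ω  ≟ 𝟘  = no λ ()
ω  ≟ 𝟙  = no λ ()
ω  ≟ ω² = no λ ()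
ω² ≟ 𝟘  = no λ ()
ω² ≟ 𝟙  = no λ ()
ω² ≟ ω  = no λ ()

∀? : {Q : F4 → Set} → (∀ x → Dec (Q x)) → Dec (∀ x → Q x)
∀? Q? = map′ (λ { (q₀ , q₁ , q₂ , q₃) → λ { 𝟘 → q₀ ; 𝟙 → q₁ ; ω → q₂ ; ω² → q₃ } })
             (λ q → q 𝟘 , q 𝟙 , q ω , q ω²)
             (Q? 𝟘 ×-dec Q? 𝟙 ×-dec Q? ω ×-dec Q? ω²)

∀≢𝟘? : {Q : F4 → Set} → (∀ x → Dec (Q x)) → Dec (∀ x → x ≢ 𝟘 → Q x)
∀≢𝟘? Q? = map′ (λ { (q₁ , q₂ , q₃) → λ { 𝟘 𝟘≢𝟘 → ⊥-elim (𝟘≢𝟘 refl) ; 𝟙 _ → q₁ ; ω _ → q₂ ; ω² _ → q₃ } })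
               (λ q → q 𝟙 (λ ()) , q ω (λ ()) , q ω² (λ ()))
               (Q? 𝟙 ×-dec Q? ω ×-dec Q? ω²)

∃? : {Q : F4 → Set} → (∀ x → Dec (Q x)) → Dec (∃ Q)
∃? Q? = map′ (λ { (inj₁ q) → 𝟘 , q ; (inj₂ (inj₁ q)) → 𝟙 , q
                ; (inj₂ (inj₂ (inj₁ q))) → ω , q ; (inj₂ (inj₂ (inj₂ q))) → ω² , q })
             (λ { (𝟘 , q) → inj₁ q ; (𝟙 , q) → inj₂ (inj₁ q)
                ; (ω , q) → inj₂ (inj₂ (inj₁ q)) ; (ω² , q) → inj₂ (inj₂ (inj₂ q)) })
             (Q? 𝟘 ⊎-dec Q? 𝟙 ⊎-dec Q? ω ⊎-dec Q? ω²)

ℙ¹ : Set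
ℙ¹ = Maybe F4

infix 4 _≟ℙ¹_
_≟ℙ¹_ : DecidableEquality ℙ¹
_≟ℙ¹_ = ≡-dec _≟_

∀ℙ¹? : {Q : ℙ¹ → Set} → (∀ t → Dec (Q t)) → Dec (∀ t → Q t)
∀ℙ¹? Q? = map′ (λ { (q∞ , q) → λ { nothing → q∞ ; (just t) → q t } })
               (λ q → q nothing , λ t → q (just t))
               (Q? nothing ×-dec ∀? (λ t → Q? (just t)))

∃ℙ¹? : {Q : ℙ¹ → Set} → (∀ t → Dec (Q t)) → Dec (∃ Q)
∃ℙ¹? Q? = map′ (λ { (inj₁ q) → nothing , q ; (inj₂ (t , q)) → just t , q })
               (λ { (nothing , q) → inj₁ q ; (just t , q) → inj₂ (t , q) })
               (Q? nothing ⊎-dec ∃? (λ t → Q? (just t)))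

𝟙≢𝟘 : 𝟙 ≢ 𝟘
𝟙≢𝟘 ()

*-comm : ∀ x y → x * y ≡ y * x
*-comm = by-decision (∀? λ x → ∀? λ y → _ ≟ _)

*-assoc : ∀ x y z → x * y * z ≡ x * (y * z)
*-assoc = by-decision (∀? λ x → ∀? λ y → ∀? λ z → _ ≟ _)

*-left-comm : ∀ x y z → x * (y * z) ≡ y * (x * z)
*-left-comm = by-decision (∀? λ x → ∀? λ y → ∀? λ z → _ ≟ _)

*-distribˡ-+ : ∀ x y z → x * (y + z) ≡ x * y + x * z
*-distribˡ-+ = by-decision (∀? λ x → ∀? λ y → ∀? λ z → _ ≟ _)

+-interchange : ∀ a b c d → a + b + (c + d) ≡ a + c + (b + d)
+-interchange = by-decision (∀? λ a → ∀? λ b → ∀? λ c → ∀? λ d → _ ≟ _)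

*-zeroʳ : ∀ x → x * 𝟘 ≡ 𝟘
*-zeroʳ = by-decision (∀? λ x → _ ≟ _)

*-identityˡ : ∀ x → 𝟙 * x ≡ x
*-identityˡ = by-decision (∀? λ x → _ ≟ _)

infix 10 _⁻¹
_⁻¹ : F4 → F4
𝟘 ⁻¹  = 𝟘
𝟙 ⁻¹  = 𝟙
ω ⁻¹  = ω²
ω² ⁻¹ = ω

*-cancelˡ : ∀ l x → l ≢ 𝟘 → l ⁻¹ * (l * x) ≡ x
*-cancelˡ = by-decision (∀? λ l → ∀? λ x → ¬? (l ≟ 𝟘) →-dec _ ≟ _)

*-nonzero : ∀ x y → x ≢ 𝟘 → y ≢ 𝟘 → x * y ≢ 𝟘
*-nonzero = by-decision (∀? λ x → ∀? λ y → ¬? (x ≟ 𝟘) →-dec ¬? (y ≟ 𝟘) →-dec ¬? (x * y ≟ 𝟘))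

⁻¹-nonzero : ∀ x → x ≢ 𝟘 → x ⁻¹ ≢ 𝟘
⁻¹-nonzero = by-decision (∀? λ x → ¬? (x ≟ 𝟘) →-dec ¬? (x ⁻¹ ≟ 𝟘))

*-zero-cancelˡ : ∀ l x → l ≢ 𝟘 → l * x ≡ 𝟘 → x ≡ 𝟘
*-zero-cancelˡ = by-decision (∀? λ l → ∀? λ x → ¬? (l ≟ 𝟘) →-dec (l * x ≟ 𝟘) →-dec x ≟ 𝟘)

sumF-cong : ∀ n {f g : Fin n → F4} → (∀ i → f i ≡ g i) → sumF n f ≡ sumF n g
sumF-cong zero    f≗g = refl
sumF-cong (suc n) f≗g = cong₂ _+_ (f≗g zero) (sumF-cong n (λ i → f≗g (suc i)))

sumF-*ˡ : ∀ n c (f : Fin n → F4) → c * sumF n f ≡ sumF n (λ i → c * f i)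
sumF-*ˡ zero    c f = *-zeroʳ c
sumF-*ˡ (suc n) c f =
  trans (*-distribˡ-+ c (f zero) _) (cong (c * f zero +_) (sumF-*ˡ n c (λ i → f (suc i))))

sumF-*ʳ : ∀ n (f : Fin n → F4) c → sumF n f * c ≡ sumF n (λ i → f i * c)
sumF-*ʳ n f c = trans (*-comm _ c) (trans (sumF-*ˡ n c f) (sumF-cong n λ i → *-comm c (f i)))

sumF-scaled : ∀ n {f g : Fin n → F4} l → (∀ i → f i ≡ l * g i) → sumF n f ≡ l * sumF n g
sumF-scaled n l f≗lg = trans (sumF-cong n f≗lg) (sym (sumF-*ˡ n l _))

sumF-+ : ∀ n (f g : Fin n → F4) → sumF n (λ i → f i + g i) ≡ sumF n f + sumF n g
sumF-+ zero    f g = refl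
sumF-+ (suc n) f g =
  trans (cong (f zero + g zero +_) (sumF-+ n (λ i → f (suc i)) (λ i → g (suc i))))
        (+-interchange (f zero) (g zero) _ _)

sumF-𝟘 : ∀ n → sumF n (λ _ → 𝟘) ≡ 𝟘
sumF-𝟘 zero    = refl
sumF-𝟘 (suc n) = sumF-𝟘 n

sumF-swap : ∀ n m (f : Fin n → Fin m → F4) →
            sumF n (λ i → sumF m (f i)) ≡ sumF m (λ j → sumF n (λ i → f i j))
sumF-swap zero    m f = sym (sumF-𝟘 m)
sumF-swap (suc n) m f =
  trans (cong (sumF m (f zero) +_) (sumF-swap n m (λ i → f (suc i))))
        (sym (sumF-+ m (f zero) (λ j → sumF n (λ i → f (suc i) j))))

sumF-reassoc : ∀ n (c : Fin n → F4) (A : Fin n → Fin n → F4) (b : Fin n → F4) →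
               sumF n (λ k → sumF n (λ m → c m * A m k) * b k)
               ≡ sumF n (λ m → c m * sumF n (λ k → A m k * b k))
sumF-reassoc n c A b = begin
  sumF n (λ k → sumF n (λ m → c m * A m k) * b k)
    ≡⟨ sumF-cong n (λ k → sumF-*ʳ n (λ m → c m * A m k) (b k)) ⟩
  sumF n (λ k → sumF n (λ m → c m * A m k * b k))
    ≡⟨ sumF-swap n n (λ k m → c m * A m k * b k) ⟩
  sumF n (λ m → sumF n (λ k → c m * A m k * b k))
    ≡⟨ sumF-cong n (λ m → sumF-cong n (λ k → *-assoc (c m) (A m k) (b k))) ⟩
  sumF n (λ m → sumF n (λ k → c m * (A m k * b k)))
    ≡⟨ sumF-cong n (λ m → sym (sumF-*ˡ n (c m) (λ k → A m k * b k))) ⟩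
  sumF n (λ m → c m * sumF n (λ k → A m k * b k)) ∎
  where open ≡-Reasoning

infixl 7 _·_
_·_ : ∀ {n} → Mat n → Mat n → Mat n
_·_ {n} A B i j = sumF n (λ k → A i k * B k j)

infix 10 _ᵀ
_ᵀ : ∀ {n} → Mat n → Mat n
(A ᵀ) i j = A j i

infix 4 _≋_
_≋_ : ∀ {n} → Mat n → Mat n → Set
A ≋ B = ∀ i j → A i j ≡ B i j

≋-sym : ∀ {n} {A B : Mat n} → A ≋ B → B ≋ A
≋-sym A≋B i j = sym (A≋B i j)

≋-trans : ∀ {n} {A B C : Mat n} → A ≋ B → B ≋ C → A ≋ C
≋-trans A≋B B≋C i j = trans (A≋B i j) (B≋C i j)

·-cong : ∀ {n} {A A′ B B′ : Mat n} → A ≋ A′ → B ≋ B′ → A · B ≋ A′ · B′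
·-cong A≋A′ B≋B′ i j = sumF-cong _ (λ k → cong₂ _*_ (A≋A′ i k) (B≋B′ k j))

·-assoc : ∀ {n} (A B C : Mat n) → (A · B) · C ≋ A · (B · C)
·-assoc {n} A B C i j = sumF-reassoc n (A i) B (λ k → C k j)

ᵀ-· : ∀ {n} (A B : Mat n) → (A · B) ᵀ ≋ B ᵀ · A ᵀ
ᵀ-· A B i j = sumF-cong _ (λ k → *-comm (A j k) (B k i))

𝐈 : Mat 4
𝐈 zero                   = vec 𝟙 𝟘 𝟘 𝟘
𝐈 (suc zero)             = vec 𝟘 𝟙 𝟘 𝟘
𝐈 (suc (suc zero))       = vec 𝟘 𝟘 𝟙 𝟘
𝐈 (suc (suc (suc zero))) = vec 𝟘 𝟘 𝟘 𝟙

𝐈-diagonal : ∀ i → 𝐈 i i ≡ 𝟙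
𝐈-diagonal = by-decision (Fin.all? λ i → _ ≟ _)

𝐈-off-diagonal : ∀ i j → i ≢ j → 𝐈 i j ≡ 𝟘
𝐈-off-diagonal = by-decision (Fin.all? λ i → Fin.all? λ j → ¬? (i Fin.≟ j) →-dec 𝐈 i j ≟ 𝟘)

vec⟨_⟩ : Vec4 → Vec4
vec⟨ x ⟩ = vec (x zero) (x (suc zero)) (x (suc (suc zero))) (x (suc (suc (suc zero))))

vec-η : ∀ (x : Vec4) i → vec⟨ x ⟩ i ≡ x i
vec-η x zero                   = refl
vec-η x (suc zero)             = refl
vec-η x (suc (suc zero))       = refl
vec-η x (suc (suc (suc zero))) = refl

sumF-𝐈 : ∀ (y : Vec4) j → sumF 4 (λ k → y k * 𝐈 k j) ≡ y j
sumF-𝐈 y j = begin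
  sumF 4 (λ k → y k * 𝐈 k j)        ≡⟨ sumF-cong 4 (λ k → cong (_* 𝐈 k j) (sym (vec-η y k))) ⟩
  sumF 4 (λ k → vec⟨ y ⟩ k * 𝐈 k j) ≡⟨ unit-sum (y zero) _ _ _ j ⟩
  vec⟨ y ⟩ j                          ≡⟨ vec-η y j ⟩
  y j                                 ∎
  where
  open ≡-Reasoning
  unit-sum : ∀ a b c d j → sumF 4 (λ k → vec a b c d k * 𝐈 k j) ≡ vec a b c d j
  unit-sum = by-decision (∀? λ a → ∀? λ b → ∀? λ c → ∀? λ d → Fin.all? λ j → _ ≟ _)

·-identityʳ : ∀ (A : Mat 4) → A · 𝐈 ≋ A
·-identityʳ A i = sumF-𝐈 (A i)

apply-· : ∀ (A B : Mat 4) x i → apply (A · B) x i ≡ apply A (apply B x) i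
apply-· A B x i = sumF-reassoc 4 (A i) B x

apply-congˡ : ∀ {A B : Mat 4} → A ≋ B → ∀ x i → apply A x i ≡ apply B x i
apply-congˡ A≋B x i = sumF-cong 4 (λ j → cong (_* x j) (A≋B i j))

apply-congʳ : ∀ (A : Mat 4) {x y : Vec4} → (∀ i → x i ≡ y i) → ∀ i → apply A x i ≡ apply A y i
apply-congʳ A x≗y i = sumF-cong 4 (λ j → cong (A i j *_) (x≗y j))

apply-vec-η : ∀ (A : Mat 4) x i → apply A vec⟨ x ⟩ i ≡ apply A x i
apply-vec-η A x = apply-congʳ A (vec-η x)

∼-reflexive : ∀ {x y} → (∀ i → x i ≡ y i) → x ∼ y
∼-reflexive x≗y = 𝟙 , 𝟙≢𝟘 , λ i → trans (x≗y i) (sym (*-identityˡ _))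

∼-refl : ∀ {x} → x ∼ x
∼-refl = ∼-reflexive λ _ → refl

∼-sym : ∀ {x y} → x ∼ y → y ∼ x
∼-sym (l , l≢𝟘 , x≗ly) =
  l ⁻¹ , ⁻¹-nonzero l l≢𝟘 , λ i → sym (trans (cong (l ⁻¹ *_) (x≗ly i)) (*-cancelˡ l _ l≢𝟘))

∼-trans : ∀ {x y z} → x ∼ y → y ∼ z → x ∼ z
∼-trans (l , l≢𝟘 , x≗ly) (m , m≢𝟘 , y≗mz) =
  l * m , *-nonzero l m l≢𝟘 m≢𝟘 ,
  λ i → trans (x≗ly i) (trans (cong (l *_) (y≗mz i)) (sym (*-assoc l m _)))

∼-resp : ∀ {x x′ y y′} → (∀ i → x i ≡ x′ i) → (∀ i → y i ≡ y′ i) → x ∼ y → x′ ∼ y′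
∼-resp x≗x′ y≗y′ x∼y = ∼-trans (∼-reflexive (λ i → sym (x≗x′ i))) (∼-trans x∼y (∼-reflexive y≗y′))

∼-setoid : Setoid _ _
∼-setoid = record
  { Carrier = Vec4 ; _≈_ = _∼_
  ; isEquivalence = record { refl = ∼-refl ; sym = ∼-sym ; trans = ∼-trans } }

module ∼-Reasoning = SetoidReasoning ∼-setoid

infix 4 _∼?_
_∼?_ : ∀ x y → Dec (x ∼ y)
x ∼? y = ∃? λ l → ¬? (l ≟ 𝟘) ×-dec Fin.all? λ i → x i ≟ l * y i

apply-∼ : ∀ A {x y} → x ∼ y → apply A x ∼ apply A y
apply-∼ A (l , l≢𝟘 , x≗ly) = l , l≢𝟘 , λ i →
  sumF-scaled 4 l (λ j → trans (cong (A i j *_) (x≗ly j)) (*-left-comm (A i j) l _))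

infix 4 _≃_
_≃_ : Mat 4 → Mat 4 → Set
A ≃ B = Σ F4 λ l → (l ≢ 𝟘) × (A ≋ λ i j → l * B i j)

infix 4 _≃?_
_≃?_ : ∀ A B → Dec (A ≃ B)
A ≃? B = ∃? λ l → ¬? (l ≟ 𝟘) ×-dec Fin.all? λ i → Fin.all? λ j → A i j ≟ l * B i j

≃-respˡ : ∀ {M N X} → M ≋ N → N ≃ X → M ≃ X
≃-respˡ M≋N (l , l≢𝟘 , N≋lX) = l , l≢𝟘 , λ i j → trans (M≋N i j) (N≋lX i j)

≃-ᵀ : ∀ {M N} → M ≃ N → M ᵀ ≃ N ᵀ
≃-ᵀ (l , l≢𝟘 , M≋lN) = l , l≢𝟘 , λ i j → M≋lN j i

apply-≃ : ∀ {A B} → A ≃ B → ∀ x → apply A x ∼ apply B x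
apply-≃ (l , l≢𝟘 , A≋lB) x = l , l≢𝟘 , λ i →
  sumF-scaled 4 l (λ j → trans (cong (_* x j) (A≋lB i j)) (*-assoc l _ (x j)))

-- G₄* as the image of GL(2,4)

-- the matrix [[a, c], [b, d]] of t ↦ (a t + c) / (b t + d), whose image is M(a,b,c,d)
mat₂ : F4 → F4 → F4 → F4 → Mat 2
mat₂ a b c d zero       zero       = a
mat₂ a b c d zero       (suc zero) = c
mat₂ a b c d (suc zero) zero       = b
mat₂ a b c d (suc zero) (suc zero) = d

mat₂-η : ∀ (A : Mat 2) i j →
         A i j ≡ mat₂ (A zero zero) (A (suc zero) zero) (A zero (suc zero)) (A (suc zero) (suc zero)) i j
mat₂-η A zero       zero       = refl
mat₂-η A zero       (suc zero) = refl
mat₂-η A (suc zero) zero       = refl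
mat₂-η A (suc zero) (suc zero) = refl

det₂ : Mat 2 → F4
det₂ A = A zero zero * A (suc zero) (suc zero) - A (suc zero) zero * A zero (suc zero)

det₂-· : ∀ A B → det₂ (A · B) ≡ det₂ A * det₂ B
det₂-· A B = multiplicative (A zero zero) (A (suc zero) zero) (A zero (suc zero)) (A (suc zero) (suc zero))
                            (B zero zero) (B (suc zero) zero) (B zero (suc zero)) (B (suc zero) (suc zero))
  where
  multiplicative : ∀ a b c d e f g h →
                   det₂ (mat₂ a b c d · mat₂ e f g h) ≡ det₂ (mat₂ a b c d) * det₂ (mat₂ e f g h)
  multiplicative = by-decision
    (∀? λ a → ∀? λ b → ∀? λ c → ∀? λ d → ∀? λ e → ∀? λ f → ∀? λ g → ∀? λ h → _ ≟ _)

det₂-·-nonzero : ∀ A B → det₂ A ≢ 𝟘 → det₂ B ≢ 𝟘 → det₂ (A · B) ≢ 𝟘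
det₂-·-nonzero A B detA≢𝟘 detB≢𝟘 det≡𝟘 = *-nonzero _ _ detA≢𝟘 detB≢𝟘 (trans (sym (det₂-· A B)) det≡𝟘)

M⟦_⟧ : Mat 2 → Mat 4
M⟦ A ⟧ = M[ A zero zero , A (suc zero) zero , A zero (suc zero) , A (suc zero) (suc zero) ]

M⟦⟧∈G₄* : ∀ A → det₂ A ≢ 𝟘 → G4* M⟦ A ⟧
M⟦⟧∈G₄* A det≢𝟘 = _ , _ , _ , _ , 𝟙 , det≢𝟘 , 𝟙≢𝟘 , λ i j → sym (*-identityˡ _)

hi lo : Fin 4 → Fin 2
hi zero                   = zero
hi (suc zero)             = zero
hi (suc (suc zero))       = suc zero
hi (suc (suc (suc zero))) = suc zero
lo zero                   = zero
lo (suc zero)             = suc zero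
lo (suc (suc zero))       = zero
lo (suc (suc (suc zero))) = suc zero

infixl 8 _⊗_
_⊗_ : Mat 2 → Mat 2 → Mat 4
(A ⊗ B) i j = A (hi i) (hi j) * B (lo i) (lo j)

⊗-cong : ∀ {A A′ B B′ : Mat 2} → A ≋ A′ → B ≋ B′ → A ⊗ B ≋ A′ ⊗ B′
⊗-cong A≋A′ B≋B′ i j = cong₂ _*_ (A≋A′ (hi i) (hi j)) (B≋B′ (lo i) (lo j))

⊗-· : ∀ A B C D → (A ⊗ B) · (C ⊗ D) ≋ (A · C) ⊗ (B · D)
⊗-· A B C D i j =
  expand (A (hi i) zero) (A (hi i) (suc zero)) (B (lo i) zero) (B (lo i) (suc zero))
         (C zero (hi j)) (C (suc zero) (hi j)) (D zero (lo j)) (D (suc zero) (lo j))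
  where
  expand : ∀ a₀ a₁ b₀ b₁ c₀ c₁ d₀ d₁ →
    a₀ * b₀ * (c₀ * d₀) + (a₀ * b₁ * (c₀ * d₁) + (a₁ * b₀ * (c₁ * d₀) + (a₁ * b₁ * (c₁ * d₁) + 𝟘)))
    ≡ (a₀ * c₀ + (a₁ * c₁ + 𝟘)) * (b₀ * d₀ + (b₁ * d₁ + 𝟘))
  expand = by-decision
    (∀? λ a₀ → ∀? λ a₁ → ∀? λ b₀ → ∀? λ b₁ → ∀? λ c₀ → ∀? λ c₁ → ∀? λ d₀ → ∀? λ d₁ → _ ≟ _)

infix 10 _⁽²⁾
_⁽²⁾ : Mat 2 → Mat 2
(A ⁽²⁾) i j = A i j ²

⁽²⁾-· : ∀ A B → (A · B) ⁽²⁾ ≋ A ⁽²⁾ · B ⁽²⁾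
⁽²⁾-· A B i j = frobenius (A i zero) (A i (suc zero)) (B zero j) (B (suc zero) j)
  where
  frobenius : ∀ a b c d → (a * c + (b * d + 𝟘)) ² ≡ a ² * c ² + (b ² * d ² + 𝟘)
  frobenius = by-decision (∀? λ a → ∀? λ b → ∀? λ c → ∀? λ d → _ ≟ _)

M⟦⟧-⊗ : ∀ A → M⟦ A ⟧ ≋ A ⁽²⁾ ⊗ A
M⟦⟧-⊗ A i j =
  trans (entries (A zero zero) (A (suc zero) zero) (A zero (suc zero)) (A (suc zero) (suc zero)) i j)
        (sym (⊗-cong {A′ = A′ ⁽²⁾} {B′ = A′} (λ x y → cong _² (mat₂-η A x y)) (mat₂-η A) i j))
  where
  A′ = mat₂ (A zero zero) (A (suc zero) zero) (A zero (suc zero)) (A (suc zero) (suc zero))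
  entries : ∀ a b c d i j → M[ a , b , c , d ] i j ≡ (mat₂ a b c d ⁽²⁾ ⊗ mat₂ a b c d) i j
  entries = by-decision (∀? λ a → ∀? λ b → ∀? λ c → ∀? λ d → Fin.all? λ i → Fin.all? λ j → _ ≟ _)

M⟦⟧-· : ∀ A B → M⟦ A · B ⟧ ≋ M⟦ A ⟧ · M⟦ B ⟧
M⟦⟧-· A B =
  ≋-trans (M⟦⟧-⊗ (A · B))
  (≋-trans (⊗-cong {B = A · B} {B′ = A · B} (⁽²⁾-· A B) (λ _ _ → refl))
  (≋-trans (≋-sym (⊗-· (A ⁽²⁾) A (B ⁽²⁾) B))
           (·-cong (≋-sym (M⟦⟧-⊗ A)) (≋-sym (M⟦⟧-⊗ B)))))

det-cong : ∀ n {A B : Mat n} → A ≋ B → det n A ≡ det n B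
det-cong zero    A≋B = refl
det-cong (suc n) A≋B = sumF-cong (suc n) λ j →
  cong (signed j) (cong₂ _*_ (A≋B zero j) (det-cong n λ i k → A≋B (suc i) (punchIn j k)))

G4? : ∀ M → Dec (G4 M)
G4? M = ¬? (det 4 M ≟ 𝟘)
  ×-dec ∀ℙ¹? (λ t → ∃ℙ¹? λ s → apply M (P t) ∼? P s)
  ×-dec ∀ℙ¹? (λ s → ∃ℙ¹? λ t → apply M (P t) ∼? P s)

G4-resp-≋ : ∀ {M N} → M ≋ N → G4 N → G4 M
G4-resp-≋ {M} {N} M≋N (nonsingular , images , preimages) =
    (λ det≡𝟘 → nonsingular (trans (sym (det-cong 4 M≋N)) det≡𝟘))
  , (λ t → let s , Nt∼s = images t in s , transfer t Nt∼s)
  , (λ s → let t , Nt∼s = preimages s in t , transfer t Nt∼s)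
  where
  transfer : ∀ t {y} → apply N (P t) ∼ y → apply M (P t) ∼ y
  transfer t = ∼-resp (λ i → sym (apply-congˡ M≋N (P t) i)) (λ _ → refl)

G₄*⊆G₄ : ∀ M → G4* M → G4 M
G₄*⊆G₄ M (a , b , c , d , l , det≢𝟘 , l≢𝟘 , M≋lM) = G4-resp-≋ M≋lM (scaled-M∈G₄ a b c d l det≢𝟘 l≢𝟘)
  where
  scaled-M∈G₄ : ∀ a b c d l → a * d - b * c ≢ 𝟘 → l ≢ 𝟘 → G4 (λ i j → l * M[ a , b , c , d ] i j)
  scaled-M∈G₄ = by-decision (∀? λ a → ∀? λ b → ∀? λ c → ∀? λ d → ∀? λ l →
    ¬? (a * d - b * c ≟ 𝟘) →-dec ¬? (l ≟ 𝟘) →-dec G4? (λ i j → l * M[ a , b , c , d ] i j))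

-- The frame of C and the normal form of elements of G₄

frame : Fin 4 → ℙ¹
frame zero                   = nothing
frame (suc zero)             = just 𝟘
frame (suc (suc zero))       = just 𝟙
frame (suc (suc (suc zero))) = just ω

𝐁 : Mat 4
𝐁 i k = P (frame k) i

𝐁⁻¹ : Mat 4
𝐁⁻¹ zero                   = vec 𝟙 ω² ω  𝟘
𝐁⁻¹ (suc zero)             = vec 𝟘 ω² ω  𝟙
𝐁⁻¹ (suc (suc zero))       = vec 𝟘 ω  ω² 𝟘
𝐁⁻¹ (suc (suc (suc zero))) = vec 𝟘 𝟙  𝟙  𝟘

𝐁·𝐁⁻¹ : 𝐁 · 𝐁⁻¹ ≋ 𝐈
𝐁·𝐁⁻¹ = by-decision (Fin.all? λ i → Fin.all? λ j → _ ≟ _)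

frame-expansion : ∀ M → M ≋ (M · 𝐁) · 𝐁⁻¹
frame-expansion M =
  ≋-trans (≋-sym (·-identityʳ M))
  (≋-trans (·-cong {A = M} (λ _ _ → refl) (≋-sym 𝐁·𝐁⁻¹)) (≋-sym (·-assoc M 𝐁 𝐁⁻¹)))

𝟏 : Vec4
𝟏 _ = 𝟙

-- the five points of C sum to zero
P-ω²-in-frame : ∀ i → P (just ω²) i ≡ apply 𝐁 𝟏 i
P-ω²-in-frame = by-decision (Fin.all? λ i → _ ≟ _)

images : (ℙ¹ → ℙ¹) → (ℙ¹ → F4) → Mat 4
images σ ℓ i k = ℓ (frame k) * P (σ (frame k)) i

Consistent : (ℙ¹ → ℙ¹) → (ℙ¹ → F4) → Set
Consistent σ ℓ = ∀ i → apply (images σ ℓ) 𝟏 i ≡ ℓ (just ω²) * P (σ (just ω²)) i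

Surjective : (ℙ¹ → ℙ¹) → Set
Surjective σ = ∀ s → ∃ λ t → σ t ≡ s

⟨_,_,_,_,_⟩ : {X : Set} → X → X → X → X → X → ℙ¹ → X
⟨ x∞ , x₀ , x₁ , xω , xω² ⟩ nothing   = x∞
⟨ x∞ , x₀ , x₁ , xω , xω² ⟩ (just 𝟘)  = x₀
⟨ x∞ , x₀ , x₁ , xω , xω² ⟩ (just 𝟙)  = x₁
⟨ x∞ , x₀ , x₁ , xω , xω² ⟩ (just ω)  = xω
⟨ x∞ , x₀ , x₁ , xω , xω² ⟩ (just ω²) = xω²

tabulate-ℙ¹ : {X : Set} → (ℙ¹ → X) → ℙ¹ → X
tabulate-ℙ¹ f = ⟨ f nothing , f (just 𝟘) , f (just 𝟙) , f (just ω) , f (just ω²) ⟩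

tabulate-ℙ¹-η : {X : Set} (f : ℙ¹ → X) → ∀ t → tabulate-ℙ¹ f t ≡ f t
tabulate-ℙ¹-η f nothing   = refl
tabulate-ℙ¹-η f (just 𝟘)  = refl
tabulate-ℙ¹-η f (just 𝟙)  = refl
tabulate-ℙ¹-η f (just ω)  = refl
tabulate-ℙ¹-η f (just ω²) = refl

P-injective : ∀ s t → P s ∼ P t → s ≡ t
P-injective = by-decision (∀ℙ¹? λ s → ∀ℙ¹? λ t → P s ∼? P t →-dec s ≟ℙ¹ t)

hom : ℙ¹ → Fin 2 → F4
hom nothing  zero       = 𝟙
hom nothing  (suc zero) = 𝟘
hom (just t) zero       = t
hom (just t) (suc zero) = 𝟙

det₂ᵛ : (Fin 2 → F4) → (Fin 2 → F4) → F4
det₂ᵛ u v = u zero * v (suc zero) - u (suc zero) * v zero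

-- the Möbius transformation mapping ∞, 0, 1 to p, q, r: its columns are α p and β q,
-- where α p + β q = det(p, q) r by Cramer's rule
möbius : ℙ¹ → ℙ¹ → ℙ¹ → Mat 2
möbius p q r = mat₂ (α * hom p zero) (α * hom p (suc zero)) (β * hom q zero) (β * hom q (suc zero))
  where
  α = det₂ᵛ (hom r) (hom q)
  β = det₂ᵛ (hom p) (hom r)

-- swaps the two tensor factors; on C it induces t ↦ t²
𝐒 : Mat 4
𝐒 zero                   = vec 𝟙 𝟘 𝟘 𝟘
𝐒 (suc zero)             = vec 𝟘 𝟘 𝟙 𝟘
𝐒 (suc (suc zero))       = vec 𝟘 𝟙 𝟘 𝟘
𝐒 (suc (suc (suc zero))) = vec 𝟘 𝟘 𝟘 𝟙

CosetRep : Mat 2 → Mat 4 → Set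
CosetRep A N = det₂ A ≢ 𝟘 × (N ≃ M⟦ A ⟧ ⊎ N ≃ M⟦ A ⟧ · 𝐒)

CosetRep? : ∀ A N → Dec (CosetRep A N)
CosetRep? A N = ¬? (det₂ A ≟ 𝟘) ×-dec (N ≃? M⟦ A ⟧ ⊎-dec N ≃? M⟦ A ⟧ · 𝐒)

-- Opaque, so that using these lemmas never unfolds the exhaustive checks behind them.
opaque
  curve-permutation-normal-form :
    ∀ (s∞ s₀ s₁ sω sω² : ℙ¹) → let σ = ⟨ s∞ , s₀ , s₁ , sω , sω² ⟩ in Surjective σ →
    ∀ l∞ → l∞ ≢ 𝟘 → ∀ l₀ → l₀ ≢ 𝟘 → ∀ l₁ → l₁ ≢ 𝟘 → ∀ lω → lω ≢ 𝟘 → ∀ lω² → lω² ≢ 𝟘 →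
    let ℓ = ⟨ l∞ , l₀ , l₁ , lω , lω² ⟩ in
    Consistent σ ℓ → CosetRep (möbius s∞ s₀ s₁) (images σ ℓ · 𝐁⁻¹)
  curve-permutation-normal-form = by-decision
    (∀ℙ¹? λ s∞ → ∀ℙ¹? λ s₀ → ∀ℙ¹? λ s₁ → ∀ℙ¹? λ sω → ∀ℙ¹? λ sω² →
     let σ = ⟨ s∞ , s₀ , s₁ , sω , sω² ⟩ in
     ∀ℙ¹? (λ s → ∃ℙ¹? λ t → σ t ≟ℙ¹ s) →-dec
     (∀≢𝟘? λ l∞ → ∀≢𝟘? λ l₀ → ∀≢𝟘? λ l₁ → ∀≢𝟘? λ lω → ∀≢𝟘? λ lω² →
      let ℓ = ⟨ l∞ , l₀ , l₁ , lω , lω² ⟩ in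
      (Fin.all? λ i → _ ≟ _) →-dec CosetRep? (möbius s∞ s₀ s₁) (images σ ℓ · 𝐁⁻¹)))

  G₄-normal-form : ∀ M → G4 M → Σ (Mat 2) λ A → CosetRep A M
  G₄-normal-form M (_ , onto , surjective) =
    let det≢𝟘 , N-cases = curve-permutation-normal-form
                            (σ nothing) (σ (just 𝟘)) (σ (just 𝟙)) (σ (just ω)) (σ (just ω²)) tabulated-surjective
                            (ℓ nothing) (ℓ≢𝟘 nothing) (ℓ (just 𝟘)) (ℓ≢𝟘 (just 𝟘)) (ℓ (just 𝟙)) (ℓ≢𝟘 (just 𝟙))
                            (ℓ (just ω)) (ℓ≢𝟘 (just ω)) (ℓ (just ω²)) (ℓ≢𝟘 (just ω²)) consistent
    in möbius (σ nothing) (σ (just 𝟘)) (σ (just 𝟙)) , det≢𝟘 , ⊎-map (≃-respˡ M≋N) (≃-respˡ M≋N) N-cases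
    where
    σ : ℙ¹ → ℙ¹
    σ t = proj₁ (onto t)
    ℓ : ℙ¹ → F4
    ℓ t = proj₁ (proj₂ (onto t))
    ℓ≢𝟘 : ∀ t → ℓ t ≢ 𝟘
    ℓ≢𝟘 t = proj₁ (proj₂ (proj₂ (onto t)))
    image : ∀ t i → apply M (P t) i ≡ ℓ t * P (σ t) i
    image t = proj₂ (proj₂ (proj₂ (onto t)))

    tabulated-surjective : Surjective (tabulate-ℙ¹ σ)
    tabulated-surjective s =
      let t , Mt∼s = surjective s
      in t , trans (tabulate-ℙ¹-η σ t) (P-injective (σ t) s (∼-trans (∼-sym (proj₂ (onto t))) Mt∼s))

    M·𝐁≋images : M · 𝐁 ≋ images σ ℓ
    M·𝐁≋images i k = image (frame k) i

    M≋N : M ≋ images σ ℓ · 𝐁⁻¹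
    M≋N = ≋-trans (frame-expansion M) (·-cong {B = 𝐁⁻¹} M·𝐁≋images (λ _ _ → refl))

    consistent : Consistent σ ℓ
    consistent i = begin
      apply (images σ ℓ) 𝟏 i          ≡⟨ apply-congˡ (≋-sym M·𝐁≋images) 𝟏 i ⟩
      apply (M · 𝐁) 𝟏 i               ≡⟨ apply-· M 𝐁 𝟏 i ⟩
      apply M (apply 𝐁 𝟏) i           ≡⟨ apply-congʳ M (λ j → sym (P-ω²-in-frame j)) i ⟩
      apply M (P (just ω²)) i         ≡⟨ image (just ω²) i ⟩
      ℓ (just ω²) * P (σ (just ω²)) i ∎
      where open ≡-Reasoning

-- Orbits of points

_∼⟨G₄*⟩_ : Vec4 → Vec4 → Set
x ∼⟨G₄*⟩ y = Σ (Mat 2) λ A → det₂ A ≢ 𝟘 × apply M⟦ A ⟧ x ∼ y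

∃Mat₂ : (Mat 2 → Set) → Set
∃Mat₂ Q = ∃ λ a → ∃ λ b → ∃ λ c → ∃ λ d → Q (mat₂ a b c d)

∃Mat₂? : {Q : Mat 2 → Set} → (∀ A → Dec (Q A)) → Dec (∃Mat₂ Q)
∃Mat₂? Q? = ∃? λ a → ∃? λ b → ∃? λ c → ∃? λ d → Q? (mat₂ a b c d)

opaque
  𝐒-point-in-G₄*-orbit : ∀ x → x ∼⟨G₄*⟩ apply 𝐒 x
  𝐒-point-in-G₄*-orbit x =
    let a , b , c , d , det≢𝟘 , Gx∼𝐒x =
          check (x zero) (x (suc zero)) (x (suc (suc zero))) (x (suc (suc (suc zero))))
    in mat₂ a b c d , det≢𝟘 , ∼-resp (apply-vec-η M⟦ mat₂ a b c d ⟧ x) (apply-vec-η 𝐒 x) Gx∼𝐒x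
    where
    check : ∀ a b c d → ∃Mat₂ λ G → det₂ G ≢ 𝟘 × apply M⟦ G ⟧ (vec a b c d) ∼ apply 𝐒 (vec a b c d)
    check = by-decision (∀? λ a → ∀? λ b → ∀? λ c → ∀? λ d →
      ∃Mat₂? λ G → ¬? (det₂ G ≟ 𝟘) ×-dec apply M⟦ G ⟧ (vec a b c d) ∼? apply 𝐒 (vec a b c d))

G₄-point-image-in-G₄*-orbit : ∀ M x → G4 M → x ∼⟨G₄*⟩ apply M x
G₄-point-image-in-G₄*-orbit M x g with G₄-normal-form M g
... | A , det≢𝟘 , inj₁ M≃A = A , det≢𝟘 , ∼-sym (apply-≃ M≃A x)
... | A , det≢𝟘 , inj₂ M≃A𝐒 =
  let G , detG≢𝟘 , Gx∼𝐒x = 𝐒-point-in-G₄*-orbit x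
  in A · G , det₂-·-nonzero A G det≢𝟘 detG≢𝟘 , (begin
    apply M⟦ A · G ⟧ x             ≈⟨ ∼-reflexive (apply-congˡ (M⟦⟧-· A G) x) ⟩
    apply (M⟦ A ⟧ · M⟦ G ⟧) x       ≈⟨ ∼-reflexive (apply-· M⟦ A ⟧ M⟦ G ⟧ x) ⟩
    apply M⟦ A ⟧ (apply M⟦ G ⟧ x)   ≈⟨ apply-∼ M⟦ A ⟧ Gx∼𝐒x ⟩
    apply M⟦ A ⟧ (apply 𝐒 x)        ≈⟨ ∼-reflexive (λ i → sym (apply-· M⟦ A ⟧ 𝐒 x i)) ⟩
    apply (M⟦ A ⟧ · 𝐒) x            ≈⟨ ∼-sym (apply-≃ M≃A𝐒 x) ⟩
    apply M x                       ∎)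
  where open ∼-Reasoning

point-orbits : ∀ x y → PointOrb G4 x y ⇔ PointOrb G4* x y
point-orbits x y = mk⇔
  (λ (M , g , Mx∼y) → let A , det≢𝟘 , Ax∼Mx = G₄-point-image-in-G₄*-orbit M x g
                      in M⟦ A ⟧ , M⟦⟧∈G₄* A det≢𝟘 , ∼-trans Ax∼Mx Mx∼y)
  (λ (M , g* , Mx∼y) → M , G₄*⊆G₄ M g* , Mx∼y)

-- Orbits of planes

⟪_,_⟫ : Vec4 → Vec4 → F4
⟪ u , x ⟫ = sumF 4 (λ i → u i * x i)

𝐞 : Fin 4 → Vec4
𝐞 i k = 𝐈 k i

𝐞-nonzero : ∀ i → NonZero (𝐞 i)
𝐞-nonzero i = i , λ 𝐈ᵢᵢ≡𝟘 → 𝟙≢𝟘 (trans (sym (𝐈-diagonal i)) 𝐈ᵢᵢ≡𝟘)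

⟪⟫-𝐞 : ∀ y i → ⟪ y , 𝐞 i ⟫ ≡ y i
⟪⟫-𝐞 = sumF-𝐈

⟪⟫-pair : ∀ y i j a b → ⟪ y , (λ k → a * 𝐞 i k + b * 𝐞 j k) ⟫ ≡ a * y i + b * y j
⟪⟫-pair y i j a b = begin
  sumF 4 (λ k → y k * (a * 𝐞 i k + b * 𝐞 j k))
    ≡⟨ sumF-cong 4 (λ k → distrib (y k) a (𝐞 i k) b (𝐞 j k)) ⟩
  sumF 4 (λ k → a * (y k * 𝐞 i k) + b * (y k * 𝐞 j k))
    ≡⟨ sumF-+ 4 (λ k → a * (y k * 𝐞 i k)) (λ k → b * (y k * 𝐞 j k)) ⟩
  sumF 4 (λ k → a * (y k * 𝐞 i k)) + sumF 4 (λ k → b * (y k * 𝐞 j k))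
    ≡⟨ sym (cong₂ _+_ (sumF-*ˡ 4 a (λ k → y k * 𝐞 i k)) (sumF-*ˡ 4 b (λ k → y k * 𝐞 j k))) ⟩
  a * ⟪ y , 𝐞 i ⟫ + b * ⟪ y , 𝐞 j ⟫
    ≡⟨ cong₂ (λ p q → a * p + b * q) (⟪⟫-𝐞 y i) (⟪⟫-𝐞 y j) ⟩
  a * y i + b * y j ∎
  where
  open ≡-Reasoning
  distrib : ∀ y a e b f → y * (a * e + b * f) ≡ a * (y * e) + b * (y * f)
  distrib = by-decision (∀? λ y → ∀? λ a → ∀? λ e → ∀? λ b → ∀? λ f → _ ≟ _)

⟪⟫-ᵀ : ∀ M v x → ⟪ v , apply M x ⟫ ≡ ⟪ apply (M ᵀ) v , x ⟫
⟪⟫-ᵀ M v x = sym (trans (sumF-cong 4 λ j → cong (_* x j) (sumF-cong 4 λ i → *-comm (M i j) (v i)))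
                        (sumF-reassoc 4 v M x))

-- With uᵢ ≠ 0, the point uⱼ eᵢ + uᵢ eⱼ lies on the plane u (characteristic 2), hence on w,
-- which forces wᵢ uⱼ = uᵢ wⱼ.
plane-coordinates-unique : ∀ u w → NonZero u → (∀ x → NonZero x → (OnPlane u x ⇔ OnPlane w x)) → u ∼ w
plane-coordinates-unique u w (i , uᵢ≢𝟘) same-points = u i * w i ⁻¹ , ratio≢𝟘 , coordinate
  where
  wᵢ≢𝟘 : w i ≢ 𝟘
  wᵢ≢𝟘 wᵢ≡𝟘 = uᵢ≢𝟘 (trans (sym (⟪⟫-𝐞 u i))
    (Equivalence.from (same-points (𝐞 i) (𝐞-nonzero i)) (trans (⟪⟫-𝐞 w i) wᵢ≡𝟘)))

  ratio≢𝟘 : u i * w i ⁻¹ ≢ 𝟘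
  ratio≢𝟘 = *-nonzero _ _ uᵢ≢𝟘 (⁻¹-nonzero _ wᵢ≢𝟘)

  coordinate : ∀ j → u j ≡ u i * w i ⁻¹ * w j
  coordinate j with j Fin.≟ i
  ... | yes refl = cancel (u i) (w i) wᵢ≢𝟘
    where
    cancel : ∀ a c → c ≢ 𝟘 → a ≡ a * c ⁻¹ * c
    cancel = by-decision (∀? λ a → ∀? λ c → ¬? (c ≟ 𝟘) →-dec _ ≟ _)
  ... | no j≢i = ratio (u i) (u j) (w i) (w j) uᵢ≢𝟘 wᵢ≢𝟘 (trans (sym (⟪⟫-pair w i j (u j) (u i))) w·x≡𝟘)
    where
    x : Vec4
    x k = u j * 𝐞 i k + u i * 𝐞 j k

    xⱼ≡uᵢ : x j ≡ u i
    xⱼ≡uᵢ = trans (cong₂ (λ p q → u j * p + u i * q) (𝐈-off-diagonal j i j≢i) (𝐈-diagonal j))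
                  (unit (u j) (u i))
      where
      unit : ∀ a b → a * 𝟘 + b * 𝟙 ≡ b
      unit = by-decision (∀? λ a → ∀? λ b → _ ≟ _)

    u·x≡𝟘 : ⟪ u , x ⟫ ≡ 𝟘
    u·x≡𝟘 = trans (⟪⟫-pair u i j (u j) (u i)) (self-cancel (u j) (u i))
      where
      self-cancel : ∀ a b → a * b + b * a ≡ 𝟘
      self-cancel = by-decision (∀? λ a → ∀? λ b → _ ≟ _)

    w·x≡𝟘 : ⟪ w , x ⟫ ≡ 𝟘
    w·x≡𝟘 = Equivalence.to (same-points x (j , λ xⱼ≡𝟘 → uᵢ≢𝟘 (trans (sym xⱼ≡uᵢ) xⱼ≡𝟘))) u·x≡𝟘

    ratio : ∀ a b c d → a ≢ 𝟘 → c ≢ 𝟘 → b * c + a * d ≡ 𝟘 → b ≡ a * c ⁻¹ * d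
    ratio = by-decision (∀? λ a → ∀? λ b → ∀? λ c → ∀? λ d →
      ¬? (a ≟ 𝟘) →-dec ¬? (c ≟ 𝟘) →-dec (b * c + a * d ≟ 𝟘) →-dec _ ≟ _)

OnPlane-∼ : ∀ {u w} → u ∼ w → ∀ x → OnPlane u x ⇔ OnPlane w x
OnPlane-∼ {u} {w} (l , l≢𝟘 , u≗lw) x = mk⇔
  (λ u·x≡𝟘 → *-zero-cancelˡ l _ l≢𝟘 (trans (sym u·x≡l*w·x) u·x≡𝟘))
  (λ w·x≡𝟘 → trans u·x≡l*w·x (trans (cong (l *_) w·x≡𝟘) (*-zeroʳ l)))
  where
  u·x≡l*w·x : ⟪ u , x ⟫ ≡ l * ⟪ w , x ⟫
  u·x≡l*w·x = sumF-scaled 4 l (λ i → trans (cong (_* x i) (u≗lw i)) (*-assoc l (w i) (x i)))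

maps-plane⇒coordinates : ∀ M u v → NonZero u → MapsPlane M u v → u ∼ apply (M ᵀ) v
maps-plane⇒coordinates M u v u≢𝟎 maps = plane-coordinates-unique u (apply (M ᵀ) v) u≢𝟎 λ x x≢𝟎 →
  let open Equivalence (maps x x≢𝟎)
  in mk⇔ (λ u·x≡𝟘 → trans (sym (⟪⟫-ᵀ M v x)) (to u·x≡𝟘)) (λ Mᵀv·x≡𝟘 → from (trans (⟪⟫-ᵀ M v x) Mᵀv·x≡𝟘))

coordinates⇒maps-plane : ∀ M u v → u ∼ apply (M ᵀ) v → MapsPlane M u v
coordinates⇒maps-plane M u v u∼Mᵀv x _ =
  let open Equivalence (OnPlane-∼ u∼Mᵀv x)
  in mk⇔ (λ u·x≡𝟘 → trans (⟪⟫-ᵀ M v x) (to u·x≡𝟘)) (λ v·Mx≡𝟘 → from (trans (sym (⟪⟫-ᵀ M v x)) v·Mx≡𝟘))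

_∼⟨G₄*ᵀ⟩_ : Vec4 → Vec4 → Set
v ∼⟨G₄*ᵀ⟩ w = Σ (Mat 2) λ A → det₂ A ≢ 𝟘 × apply (M⟦ A ⟧ ᵀ) v ∼ w

opaque
  𝐒ᵀ-plane-in-G₄*-orbit : ∀ v → v ∼⟨G₄*ᵀ⟩ apply (𝐒 ᵀ) v
  𝐒ᵀ-plane-in-G₄*-orbit v =
    let a , b , c , d , det≢𝟘 , Gv∼𝐒v =
          check (v zero) (v (suc zero)) (v (suc (suc zero))) (v (suc (suc (suc zero))))
    in mat₂ a b c d , det≢𝟘 , ∼-resp (apply-vec-η (M⟦ mat₂ a b c d ⟧ ᵀ) v) (apply-vec-η (𝐒 ᵀ) v) Gv∼𝐒v
    where
    check : ∀ a b c d →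
            ∃Mat₂ λ G → det₂ G ≢ 𝟘 × apply (M⟦ G ⟧ ᵀ) (vec a b c d) ∼ apply (𝐒 ᵀ) (vec a b c d)
    check = by-decision (∀? λ a → ∀? λ b → ∀? λ c → ∀? λ d →
      ∃Mat₂? λ G → ¬? (det₂ G ≟ 𝟘) ×-dec apply (M⟦ G ⟧ ᵀ) (vec a b c d) ∼? apply (𝐒 ᵀ) (vec a b c d))

G₄-plane-preimage-in-G₄*-orbit : ∀ M v → G4 M → v ∼⟨G₄*ᵀ⟩ apply (M ᵀ) v
G₄-plane-preimage-in-G₄*-orbit M v g with G₄-normal-form M g
... | A , det≢𝟘 , inj₁ M≃A = A , det≢𝟘 , ∼-sym (apply-≃ (≃-ᵀ M≃A) v)
... | A , det≢𝟘 , inj₂ M≃A𝐒 =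
  let w = apply (M⟦ A ⟧ ᵀ) v
      G , detG≢𝟘 , Gw∼𝐒w = 𝐒ᵀ-plane-in-G₄*-orbit w
  in A · G , det₂-·-nonzero A G det≢𝟘 detG≢𝟘 , (begin
    apply (M⟦ A · G ⟧ ᵀ) v          ≈⟨ ∼-reflexive (apply-congˡ (λ i j → M⟦⟧-· A G j i) v) ⟩
    apply ((M⟦ A ⟧ · M⟦ G ⟧) ᵀ) v    ≈⟨ ∼-reflexive (apply-congˡ (ᵀ-· M⟦ A ⟧ M⟦ G ⟧) v) ⟩
    apply (M⟦ G ⟧ ᵀ · M⟦ A ⟧ ᵀ) v    ≈⟨ ∼-reflexive (apply-· (M⟦ G ⟧ ᵀ) (M⟦ A ⟧ ᵀ) v) ⟩
    apply (M⟦ G ⟧ ᵀ) w              ≈⟨ Gw∼𝐒w ⟩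
    apply (𝐒 ᵀ) w                   ≈⟨ ∼-reflexive (λ i → sym (apply-· (𝐒 ᵀ) (M⟦ A ⟧ ᵀ) v i)) ⟩
    apply (𝐒 ᵀ · M⟦ A ⟧ ᵀ) v        ≈⟨ ∼-reflexive (apply-congˡ (≋-sym (ᵀ-· M⟦ A ⟧ 𝐒)) v) ⟩
    apply ((M⟦ A ⟧ · 𝐒) ᵀ) v        ≈⟨ ∼-sym (apply-≃ (≃-ᵀ M≃A𝐒) v) ⟩
    apply (M ᵀ) v                   ∎)
  where open ∼-Reasoning

plane-orbits : ∀ u v → NonZero u → PlaneOrb G4 u v ⇔ PlaneOrb G4* u v
plane-orbits u v u≢𝟎 = mk⇔
  (λ (M , g , maps) →
     let A , det≢𝟘 , Aᵀv∼Mᵀv = G₄-plane-preimage-in-G₄*-orbit M v g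
     in M⟦ A ⟧ , M⟦⟧∈G₄* A det≢𝟘
        , coordinates⇒maps-plane M⟦ A ⟧ u v
            (∼-trans (maps-plane⇒coordinates M u v u≢𝟎 maps) (∼-sym Aᵀv∼Mᵀv)))
  (λ (M , g* , maps) → M , G₄*⊆G₄ M g* , maps)

theorem6p2 : ((x y : Vec4) → NonZero x → NonZero y → (PointOrb G4 x y ⇔ PointOrb G4* x y))
    × ((u v : Vec4) → NonZero u → NonZero v → (PlaneOrb G4 u v ⇔ PlaneOrb G4* u v))
theorem6p2 = (λ x y _ _ → point-orbits x y) , (λ u v u≢𝟎 _ → plane-orbits u v u≢𝟎)
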